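{- Let $S$ be a numerical monoid with $S\ne\mathbb N_0$. (1) The monoid $\mathcal P_{\mathrm{fin}}(S)$ has no prime elements. (2) If $\mathcal P_{\mathrm{fin}}(S)=H_1\oplus H_2$ for some submonoids $H_1$ and $H_2$, then $H_1=\{\{0\}\}$ or $H_2=\{\{0\}\}$. (3) If $S'$ is a numerical monoid such that $\mathcal P_{\mathrm{fin}}(S')$ is isomorphic (as a monoid) to $\mathcal P_{\mathrm{fin}}(S)$, then $S=S'$.
   Context: A numerical monoid is an additive submonoid $S\subset\mathbb N_0$ with $\gcd(S)=1$. $\mathcal P_{\mathrm{fin}}(S)$ is the set of all finite nonempty subsets of $S$ with set addition $A+B=\{a+b\colon a\in A,b\in B\}$ as operation; its identity is $\{0\}$, its only invertible element. $A$ divides $B$ if $B=A+C$ for some $C\in\mathcal P_{\mathrm{fin}}(S)$. An element $P$ is prime if $P\ne\{0\}$ and whenever $P$ divides $A+B$ then $P$ divides $A$ or $P$ divides $B$. For submonoids $H_1,H_2$, $H=H_1\oplus H_2$ means every element of $H$ is uniquely $h_1+h_2$ with $h_i\in H_i$. -}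

module Defs where

open import Data.Nat using (ℕ; zero; suc; _+_)
open import Data.Nat.GCD using (gcd)
open import Data.List using (List; []; _∷_; map; _++_; foldr)
open import Data.List.Relation.Unary.All using (All; []; _∷_)
open import Data.List.Relation.Unary.All.Properties using (++⁺)
open import Data.List.Membership.Propositional using (_∈_)
open import Data.Product using (Σ; ∃; ∃₂; _×_; _,_)
open import Data.Sum using (_⊎_)
open import Relation.Nullary using (¬_)
open import Relation.Binary.PropositionalEquality using (_≡_)
open import Function.Bundles using (_⇔_)

-- A numerical monoid: an additive submonoid S ⊆ ℕ₀ with gcd(S) = 1.
-- gcd(S) = 1 is witnessed by finitely many elements of S whose gcd is 1
-- (the gcd of a subset of ℕ is always the gcd of a finite subset).
record NumericalMonoid : Set₁ where
  field
    S        : ℕ → Set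
    0∈S      : S 0
    +-closed : ∀ {a b} → S a → S b → S (a + b)
    gcd≡1    : Σ (List ℕ) (λ gs → All S gs × foldr gcd 0 gs ≡ 1)

open NumericalMonoid public

NotAllℕ : NumericalMonoid → Set
NotAllℕ M = ∃ λ n → ¬ S M n

-- Finite nonempty subsets of S, represented by a nonempty list of
-- elements (head ∷ tail) all lying in S; equality is set equality _≋_.
record FinSub (M : NumericalMonoid) : Set where
  constructor fsub
  field
    hd  : ℕ
    tl  : List ℕ
    inS : All (S M) (hd ∷ tl)

open FinSub public

elems : ∀ {M} → FinSub M → List ℕ
elems A = hd A ∷ tl A

_≋_ : ∀ {M} → FinSub M → FinSub M → Set
A ≋ B = ∀ n → (n ∈ elems A) ⇔ (n ∈ elems B)

infix 4 _≋_

addL : List ℕ → List ℕ → List ℕ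
addL []       ys = []
addL (x ∷ xs) ys = map (x +_) ys ++ addL xs ys

private
  all-map+ : ∀ {M : NumericalMonoid} {x} ys → S M x → All (S M) ys → All (S M) (map (x +_) ys)
  all-map+ [] sx [] = []
  all-map+ {M} (y ∷ ys) sx (sy ∷ sys) = +-closed M sx sy ∷ all-map+ {M} ys sx sys

  all-addL : ∀ {M : NumericalMonoid} xs ys → All (S M) xs → All (S M) ys → All (S M) (addL xs ys)
  all-addL [] ys _ _ = []
  all-addL {M} (x ∷ xs) ys (sx ∷ sxs) sys = ++⁺ (all-map+ {M} ys sx sys) (all-addL {M} xs ys sxs sys)

_⊕_ : ∀ {M} → FinSub M → FinSub M → FinSub M
_⊕_ {M} (fsub a as (sa ∷ sas)) (fsub b bs (sb ∷ sbs)) =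
  fsub (a + b) (map (a +_) bs ++ addL as (b ∷ bs))
    (+-closed M sa sb ∷ ++⁺ (all-map+ {M} bs sa sbs) (all-addL {M} as (b ∷ bs) sas (sb ∷ sbs)))

infixl 6 _⊕_

𝟘 : ∀ {M} → FinSub M
𝟘 {M} = fsub 0 [] (0∈S M ∷ [])

_∣ₚ_ : ∀ {M} → FinSub M → FinSub M → Set
_∣ₚ_ {M} A B = Σ (FinSub M) (λ C → B ≋ A ⊕ C)

IsPrime : ∀ {M} → FinSub M → Set
IsPrime {M} P = ¬ (P ≋ 𝟘) × ((A B : FinSub M) → P ∣ₚ (A ⊕ B) → (P ∣ₚ A) ⊎ (P ∣ₚ B))

record Submonoid (M : NumericalMonoid) : Set₁ where
  field
    mem      : FinSub M → Set
    mem-resp : ∀ {A B} → A ≋ B → mem A → mem B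
    mem-𝟘    : mem 𝟘
    mem-⊕    : ∀ {A B} → mem A → mem B → mem (A ⊕ B)

open Submonoid public

IsDirectSum : ∀ {M} → Submonoid M → Submonoid M → Set
IsDirectSum {M} H₁ H₂ =
  ((A : FinSub M) → ∃₂ λ h₁ h₂ → mem H₁ h₁ × mem H₂ h₂ × A ≋ h₁ ⊕ h₂)
  × ((h₁ h₂ h₁' h₂' : FinSub M) → mem H₁ h₁ → mem H₂ h₂ → mem H₁ h₁' → mem H₂ h₂'
      → h₁ ⊕ h₂ ≋ h₁' ⊕ h₂' → (h₁ ≋ h₁') × (h₂ ≋ h₂'))

IsTrivial : ∀ {M} → Submonoid M → Set
IsTrivial {M} H = (A : FinSub M) → mem H A → A ≋ 𝟘

record PfinIso (M₁ M₂ : NumericalMonoid) : Set where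
  field
    to        : FinSub M₁ → FinSub M₂
    from      : FinSub M₂ → FinSub M₁
    to-cong   : ∀ {A B} → A ≋ B → to A ≋ to B
    from-cong : ∀ {A B} → A ≋ B → from A ≋ from B
    from-to   : ∀ A → from (to A) ≋ A
    to-from   : ∀ B → to (from B) ≋ B
    to-⊕      : ∀ A B → to (A ⊕ B) ≋ to A ⊕ to B
    to-𝟘      : to 𝟘 ≋ 𝟘

{-# OPTIONS --safe #-}
-- Let c be the conductor of S, so that integer intervals above c lie in S; adding a set
-- of diameter d to an interval of length ≥ d gives again an interval.
--
-- Singletons are exactly the cancellative elements of P_fin(S): a set X of diameter
-- d > 0 has X + [c, c + 2d] = X + ([c, c + 2d] ∖ {c + d}).  An isomorphism
-- P_fin(S) ≅ P_fin(S') therefore induces an additive bijection τ : S → S', and the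
-- homogeneity b τ(a) = a τ(b) together with gcd 1 on both sides forces τ = id.
--
-- In a decomposition H₁ ⊕ H₂, the summand containing a positive singleton contains all
-- singletons.  The other component of an interval then depends only on its length, is
-- additive in it and bounded by it, hence is {0}; every B ∈ H₂ is such a component.
--
-- There are no primes: {p} with p > 0 divides {(j + 2) w} = {(j + 1) w} + {w} but
-- neither summand, for w ∈ S ∖ (p + S) and j the last index with (j + 1) w ∉ p + S;
-- a set Q of diameter d > 0 divides the interval A + B for A = [0, d] ∪ {2d + 1},
-- B = {0} ∪ [d + 1, 2d + 1] (shifted above c), but neither A nor B.
module Submission where

open import Defs
open import Data.Nat using (ℕ; zero; suc; _+_; _*_; _∸_; _≤_; _<_; z≤n; s≤s; z<s; _≤?_; _<?_; >-nonZero)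
open import Data.Nat.Properties
open import Data.Nat.DivMod using (_/_; _%_; m≡m%n+[m/n]*n; m%n<n)
open import Data.Nat.GCD using (gcd; gcd-GCD; gcd-greatest; c*gcd[m,n]≡gcd[cm,cn]; module Bézout)
open import Data.Nat.Divisibility using (_∣_; _∣0; divides; ∣-antisym)
open import Data.Nat.Tactic.RingSolver using (solve-∀)
open import Data.List using (List; []; _∷_; map; _++_; foldr; applyUpTo; upTo)
open import Data.List.Relation.Unary.All as All using (All; []; _∷_)
open import Data.List.Relation.Unary.All.Properties using (++⁺)
open import Data.List.Relation.Unary.Any using (here; there)
open import Data.List.Membership.Propositional using (_∈_)
open import Data.List.Membership.Propositional.Properties
open import Data.List.Extrema.Nat as Extrema using ()
open import Data.Product using (Σ; ∃; ∃₂; _×_; _,_; proj₁; proj₂)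
open import Data.Sum using (_⊎_; inj₁; inj₂; [_,_]′)
open import Data.Empty using (⊥; ⊥-elim)
open import Relation.Nullary using (¬_; yes; no)
open import Relation.Binary.Bundles using (Setoid)
import Relation.Binary.Reasoning.Setoid as SetoidReasoning
open import Relation.Binary.PropositionalEquality
open import Function.Bundles using (_⇔_; mk⇔; Equivalence)
open import Function.Base using (_∘_)

∈-addL⁺ : ∀ {x y} xs ys → x ∈ xs → y ∈ ys → x + y ∈ addL xs ys
∈-addL⁺ (x ∷ xs) ys (here refl) y∈ = ∈-++⁺ˡ (∈-map⁺ (x +_) y∈)
∈-addL⁺ (x ∷ xs) ys (there x∈) y∈ = ∈-++⁺ʳ (map (x +_) ys) (∈-addL⁺ xs ys x∈ y∈)

∈-addL⁻ : ∀ {n} xs ys → n ∈ addL xs ys → ∃₂ λ x y → x ∈ xs × y ∈ ys × n ≡ x + y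
∈-addL⁻ (x ∷ xs) ys p with ∈-++⁻ (map (x +_) ys) p
... | inj₁ q = let y , y∈ , eq = ∈-map⁻ (x +_) q in x , y , here refl , y∈ , eq
... | inj₂ q = let x' , y , x∈ , y∈ , eq = ∈-addL⁻ xs ys q in x' , y , there x∈ , y∈ , eq

module FinSubsets (M : NumericalMonoid) where

  FS : Set
  FS = FinSub M

  -- Membership and set equality are wrapped in records so that the set is
  -- recoverable from their types (elems is not injective).
  record _∈ₛ_ (n : ℕ) (A : FS) : Set where
    constructor ⟨_⟩
    field get : n ∈ elems A
  open _∈ₛ_ public

  infix 4 _∈ₛ_ _≈_

  record _≈_ (A B : FS) : Set where
    constructor ⟪_,_⟫
    field
      fw : ∀ {n} → n ∈ₛ A → n ∈ₛ B
      bw : ∀ {n} → n ∈ₛ B → n ∈ₛ A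
  open _≈_ public

  ≈⇒≋ : ∀ {A B} → A ≈ B → A ≋ B
  ≈⇒≋ e n = mk⇔ (λ p → get (fw e ⟨ p ⟩)) (λ p → get (bw e ⟨ p ⟩))

  ≋⇒≈ : ∀ {A B} → A ≋ B → A ≈ B
  ≋⇒≈ e = ⟪ (λ p → ⟨ Equivalence.to (e _) (get p) ⟩) , (λ p → ⟨ Equivalence.from (e _) (get p) ⟩) ⟫

  ≈-refl : ∀ {A} → A ≈ A
  ≈-refl = ⟪ (λ x → x) , (λ x → x) ⟫

  ≈-sym : ∀ {A B} → A ≈ B → B ≈ A
  ≈-sym e = ⟪ bw e , fw e ⟫

  ≈-trans : ∀ {A B C} → A ≈ B → B ≈ C → A ≈ C
  ≈-trans e f = ⟪ (λ x → fw f (fw e x)) , (λ x → bw e (bw f x)) ⟫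

  ≈-setoid : Setoid _ _
  ≈-setoid = record
    { Carrier = FS ; _≈_ = _≈_
    ; isEquivalence = record { refl = ≈-refl ; sym = ≈-sym ; trans = ≈-trans } }

  module ≈-Reasoning = SetoidReasoning ≈-setoid

  ∈ₛ⇒S : ∀ {A n} → n ∈ₛ A → S M n
  ∈ₛ⇒S {A} p = All.lookup (inS A) (get p)

  hd∈ : ∀ A → hd A ∈ₛ A
  hd∈ A = ⟨ here refl ⟩

  hd∈S : ∀ A → S M (hd A)
  hd∈S A = ∈ₛ⇒S (hd∈ A)

  ∈-resp-≡ : ∀ {A m n} → m ≡ n → m ∈ₛ A → n ∈ₛ A
  ∈-resp-≡ refl p = p

  ⊕-elems : (A B : FS) → elems (A ⊕ B) ≡ addL (elems A) (elems B)
  ⊕-elems (fsub a as (_ ∷ _)) (fsub b bs (_ ∷ _)) = refl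

  ∈-⊕⁺ : ∀ {A B x y n} → x ∈ₛ A → y ∈ₛ B → n ≡ x + y → n ∈ₛ A ⊕ B
  ∈-⊕⁺ {A} {B} {x} {y} x∈ y∈ refl =
    ⟨ subst (x + y ∈_) (sym (⊕-elems A B)) (∈-addL⁺ (elems A) (elems B) (get x∈) (get y∈)) ⟩

  ∈-⊕⁻ : ∀ {A B n} → n ∈ₛ A ⊕ B → ∃₂ λ x y → x ∈ₛ A × y ∈ₛ B × n ≡ x + y
  ∈-⊕⁻ {A} {B} {n} p =
    let x , y , x∈ , y∈ , eq = ∈-addL⁻ (elems A) (elems B) (subst (n ∈_) (⊕-elems A B) (get p))
    in x , y , ⟨ x∈ ⟩ , ⟨ y∈ ⟩ , eq

  ⊕-mono : ∀ {A A' B B'} → (∀ {n} → n ∈ₛ A → n ∈ₛ A') → (∀ {n} → n ∈ₛ B → n ∈ₛ B') →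
           ∀ {n} → n ∈ₛ A ⊕ B → n ∈ₛ A' ⊕ B'
  ⊕-mono f g p = let _ , _ , x∈ , y∈ , eq = ∈-⊕⁻ p in ∈-⊕⁺ (f x∈) (g y∈) eq

  ⊕-cong : ∀ {A A' B B'} → A ≈ A' → B ≈ B' → A ⊕ B ≈ A' ⊕ B'
  ⊕-cong e f = ⟪ ⊕-mono (fw e) (fw f) , ⊕-mono (bw e) (bw f) ⟫

  ⊕-comm : ∀ A B → A ⊕ B ≈ B ⊕ A
  ⊕-comm A B = ⟪ swap , swap ⟫
    where
      swap : ∀ {C D n} → n ∈ₛ C ⊕ D → n ∈ₛ D ⊕ C
      swap p = let x , y , x∈ , y∈ , eq = ∈-⊕⁻ p in ∈-⊕⁺ y∈ x∈ (trans eq (+-comm x y))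

  ⊕-assoc : ∀ A B C → (A ⊕ B) ⊕ C ≈ A ⊕ (B ⊕ C)
  ⊕-assoc A B C = ⟪ to , from ⟫
    where
      to : ∀ {n} → n ∈ₛ (A ⊕ B) ⊕ C → n ∈ₛ A ⊕ (B ⊕ C)
      to p = let xy , z , xy∈ , z∈ , eq = ∈-⊕⁻ p ; x , y , x∈ , y∈ , eq' = ∈-⊕⁻ xy∈
             in ∈-⊕⁺ x∈ (∈-⊕⁺ y∈ z∈ refl) (trans eq (trans (cong (_+ z) eq') (+-assoc x y z)))
      from : ∀ {n} → n ∈ₛ A ⊕ (B ⊕ C) → n ∈ₛ (A ⊕ B) ⊕ C
      from p = let x , yz , x∈ , yz∈ , eq = ∈-⊕⁻ p ; y , z , y∈ , z∈ , eq' = ∈-⊕⁻ yz∈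
               in ∈-⊕⁺ (∈-⊕⁺ x∈ y∈ refl) z∈ (trans eq (trans (cong (x +_) eq') (sym (+-assoc x y z))))

  ⊕-interchange : ∀ A B C D → (A ⊕ B) ⊕ (C ⊕ D) ≈ (A ⊕ C) ⊕ (B ⊕ D)
  ⊕-interchange A B C D = begin
    (A ⊕ B) ⊕ (C ⊕ D)  ≈⟨ ⊕-assoc A B (C ⊕ D) ⟩
    A ⊕ (B ⊕ (C ⊕ D))  ≈⟨ ⊕-cong ≈-refl (⊕-assoc B C D) ⟨
    A ⊕ ((B ⊕ C) ⊕ D)  ≈⟨ ⊕-cong ≈-refl (⊕-cong (⊕-comm B C) ≈-refl) ⟩
    A ⊕ ((C ⊕ B) ⊕ D)  ≈⟨ ⊕-cong ≈-refl (⊕-assoc C B D) ⟩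
    A ⊕ (C ⊕ (B ⊕ D))  ≈⟨ ⊕-assoc A C (B ⊕ D) ⟨
    (A ⊕ C) ⊕ (B ⊕ D)  ∎
    where open ≈-Reasoning

  ∈𝟘⁻ : ∀ {n} → n ∈ₛ 𝟘 {M} → n ≡ 0
  ∈𝟘⁻ ⟨ here refl ⟩ = refl

  ⊕-identityʳ : ∀ A → A ⊕ 𝟘 ≈ A
  ⊕-identityʳ A = ⟪ to , (λ {n} p → ∈-⊕⁺ p (hd∈ 𝟘) (sym (+-identityʳ n))) ⟫
    where
      to : ∀ {n} → n ∈ₛ A ⊕ 𝟘 → n ∈ₛ A
      to p = let x , y , x∈ , y∈ , eq = ∈-⊕⁻ p
             in ∈-resp-≡ (sym (trans eq (trans (cong (x +_) (∈𝟘⁻ y∈)) (+-identityʳ x)))) x∈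

  ⊕-identityˡ : ∀ A → 𝟘 ⊕ A ≈ A
  ⊕-identityˡ A = ≈-trans (⊕-comm 𝟘 A) (⊕-identityʳ A)

  single : (s : ℕ) → S M s → FS
  single s s∈S = fsub s [] (s∈S ∷ [])

  ∈-single⁻ : ∀ {s s∈S n} → n ∈ₛ single s s∈S → n ≡ s
  ∈-single⁻ ⟨ here refl ⟩ = refl

  single-cong : ∀ {a b a∈S b∈S} → a ≡ b → single a a∈S ≈ single b b∈S
  single-cong refl = ⟪ (λ p → ∈-resp-≡ (sym (∈-single⁻ p)) (hd∈ _)) , (λ p → ∈-resp-≡ (sym (∈-single⁻ p)) (hd∈ _)) ⟫

  single-injective : ∀ {a b a∈S b∈S} → single a a∈S ≈ single b b∈S → a ≡ b
  single-injective e = ∈-single⁻ (fw e (hd∈ _))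

  single-⊕ : ∀ {a b a∈S b∈S ab∈S} → single a a∈S ⊕ single b b∈S ≈ single (a + b) ab∈S
  single-⊕ {a} {b} {a∈S} {b∈S} =
    ⟪ (λ p → let _ , _ , x∈ , y∈ , eq = ∈-⊕⁻ p
             in ⟨ here (trans eq (cong₂ _+_ (∈-single⁻ x∈) (∈-single⁻ y∈))) ⟩)
    , (λ p → ∈-⊕⁺ (hd∈ (single a a∈S)) (hd∈ (single b b∈S)) (∈-single⁻ p)) ⟫

  ⊆𝟘⇒≈𝟘 : ∀ {A} → (∀ {n} → n ∈ₛ A → n ≡ 0) → A ≈ 𝟘
  ⊆𝟘⇒≈𝟘 {A} ⊆𝟘 = ⟪ (λ p → ⟨ here (⊆𝟘 p) ⟩) , (λ p → ∈-resp-≡ (trans (⊆𝟘 (hd∈ A)) (sym (∈𝟘⁻ p))) (hd∈ A)) ⟫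

  single-summand : ∀ {s s∈S} A B → single s s∈S ≈ A ⊕ B → A ≈ single (hd A) (hd∈S A)
  single-summand A B e = ⟪ (λ p → ⟨ here (≡-hd p) ⟩) , (λ p → ∈-resp-≡ (sym (∈-single⁻ p)) (hd∈ A)) ⟫
    where
      ≡s : ∀ {x} → x ∈ₛ A → x + hd B ≡ _
      ≡s x∈ = ∈-single⁻ (bw e (∈-⊕⁺ x∈ (hd∈ B) refl))
      ≡-hd : ∀ {x} → x ∈ₛ A → x ≡ hd A
      ≡-hd x∈ = +-cancelʳ-≡ (hd B) _ _ (trans (≡s x∈) (sym (≡s (hd∈ A))))

  min max : FS → ℕ
  min A = Extrema.min (hd A) (tl A)
  max A = Extrema.max (hd A) (tl A)

  min∈ : ∀ A → min A ∈ₛ A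
  min∈ A = ⟨ Extrema.argmin-all (λ x → x) {P = _∈ elems A} (here refl) (All.tabulate there) ⟩

  max∈ : ∀ A → max A ∈ₛ A
  max∈ A = ⟨ Extrema.argmax-all (λ x → x) {P = _∈ elems A} (here refl) (All.tabulate there) ⟩

  min≤ : ∀ A {n} → n ∈ₛ A → min A ≤ n
  min≤ A ⟨ here refl ⟩ = Extrema.min≤⊤ (hd A) (tl A)
  min≤ A ⟨ there p ⟩ = All.lookup (Extrema.min≤xs (hd A) (tl A)) p

  ≤max : ∀ A {n} → n ∈ₛ A → n ≤ max A
  ≤max A ⟨ here refl ⟩ = Extrema.⊥≤max (hd A) (tl A)
  ≤max A ⟨ there p ⟩ = All.lookup (Extrema.xs≤max (hd A) (tl A)) p

  diameter : ∀ A → ∃ λ d → max A ≡ min A + d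
  diameter A = let d , eq = m≤n⇒∃[o]m+o≡n (≤-trans (min≤ A (hd∈ A)) (≤max A (hd∈ A))) in d , sym eq

  singleton⊎min<max : ∀ A → A ≈ single (hd A) (hd∈S A) ⊎ min A < max A
  singleton⊎min<max A with min A <? max A
  ... | yes min<max = inj₂ min<max
  ... | no min≮max = inj₁ ⟪ (λ p → ⟨ here (≡-hd p) ⟩) , (λ p → ∈-resp-≡ (sym (∈-single⁻ p)) (hd∈ A)) ⟫
    where
      ≡-hd : ∀ {n} → n ∈ₛ A → n ≡ hd A
      ≡-hd p = ≤-antisym (≤-trans (≤max A p) (≤-trans (≮⇒≥ min≮max) (min≤ A (hd∈ A))))
                         (≤-trans (≤max A (hd∈ A)) (≤-trans (≮⇒≥ min≮max) (min≤ A p)))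

module _ (M : NumericalMonoid) where

  S-*-closed : ∀ k {s} → S M s → S M (k * s)
  S-*-closed zero    _   = 0∈S M
  S-*-closed (suc k) s∈S = +-closed M s∈S (S-*-closed k s∈S)

  -- Nonnegative differences of elements of S are closed under integer linear
  -- combinations, so they contain gcd(S) = 1.
  Difference : ℕ → Set
  Difference d = ∃₂ λ x y → S M x × S M y × x ≡ y + d

  S⇒Difference : ∀ {s} → S M s → Difference s
  S⇒Difference {s} s∈S = s , 0 , s∈S , 0∈S M , refl

  Difference-combination : ∀ {a b d} α β → Difference a → Difference b →
                           d + β * b ≡ α * a → Difference d
  Difference-combination {a} {b} {d} α β (_ , y₁ , x₁∈S , y₁∈S , refl) (_ , y₂ , x₂∈S , y₂∈S , refl) eq =
    α * (y₁ + a) + β * y₂ , α * y₁ + β * (y₂ + b) ,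
    +-closed M (S-*-closed α x₁∈S) (S-*-closed β y₂∈S) ,
    +-closed M (S-*-closed α y₁∈S) (S-*-closed β x₂∈S) ,
    (begin
      α * (y₁ + a) + β * y₂      ≡⟨ cong (_+ β * y₂) (*-distribˡ-+ α y₁ a) ⟩
      α * y₁ + α * a + β * y₂    ≡⟨ cong (λ t → α * y₁ + t + β * y₂) eq ⟨
      α * y₁ + (d + β * b) + β * y₂ ≡⟨ lemma α y₁ d β b y₂ ⟩
      α * y₁ + β * (y₂ + b) + d  ∎)
    where
      open ≡-Reasoning
      lemma : ∀ α y₁ d β b y₂ → α * y₁ + (d + β * b) + β * y₂ ≡ α * y₁ + β * (y₂ + b) + d
      lemma = solve-∀

  Difference-gcd : ∀ {a b} → Difference a → Difference b → Difference (gcd a b)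
  Difference-gcd {a} {b} Da Db with Bézout.identity (gcd-GCD a b)
  ... | Bézout.+- α β eq = Difference-combination α β Da Db eq
  ... | Bézout.-+ α β eq = Difference-combination β α Db Da eq

  Difference-foldr-gcd : ∀ {gs} → All (S M) gs → Difference (foldr gcd 0 gs)
  Difference-foldr-gcd []           = S⇒Difference (0∈S M)
  Difference-foldr-gcd (g∈S ∷ gs∈S) = Difference-gcd (S⇒Difference g∈S) (Difference-foldr-gcd gs∈S)

  -- n = q u + r with r < u ≤ q, so n = (q ∸ r) u + r (u + 1).
  consecutive⇒conductor : ∀ {u} → S M u → S M (suc u) → ∀ n → u * u ≤ n → S M n
  consecutive⇒conductor {zero} _ 1∈S n _ = subst (S M) (*-identityʳ n) (S-*-closed n 1∈S)
  consecutive⇒conductor {u@(suc _)} u∈S u+1∈S n u²≤n with n % u ≤? n / u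
  ... | yes r≤q = subst (S M) (sym n≡) (+-closed M (S-*-closed (q ∸ r) u∈S) (S-*-closed r u+1∈S))
    where
      q = n / u
      r = n % u
      n≡ : n ≡ (q ∸ r) * u + r * suc u
      n≡ = begin
        n                        ≡⟨ m≡m%n+[m/n]*n n u ⟩
        r + q * u                ≡⟨ cong (λ t → r + t * u) (m∸n+n≡m r≤q) ⟨
        r + ((q ∸ r) + r) * u    ≡⟨ lemma r (q ∸ r) u ⟩
        (q ∸ r) * u + r * suc u  ∎
        where
          open ≡-Reasoning
          lemma : ∀ r t u → r + (t + r) * u ≡ t * u + r * suc u
          lemma = solve-∀
  ... | no r≰q = ⊥-elim (<⇒≱ n<u² u²≤n)
    where
      n<u² : n < u * u
      n<u² = begin-strict
        n                    ≡⟨ m≡m%n+[m/n]*n n u ⟩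
        n % u + n / u * u    <⟨ +-monoˡ-< (n / u * u) (m%n<n n u) ⟩
        suc (n / u) * u      ≤⟨ *-monoˡ-≤ u (<-≤-trans (≰⇒> r≰q) (<⇒≤ (m%n<n n u))) ⟩
        u * u                ∎
        where open ≤-Reasoning

  conductor : ∃ λ c → ∀ n → c ≤ n → S M n
  conductor with gcd≡1 M
  ... | gs , gs⊆S , gcd≡1 with Difference-foldr-gcd gs⊆S
  ...   | _ , u , u+1∈S , u∈S , eq rewrite gcd≡1 | +-comm u 1 =
    u * u , consecutive⇒conductor u∈S (subst (S M) eq u+1∈S)

  ¬1∈S : NotAllℕ M → ¬ S M 1
  ¬1∈S (n , n∉S) 1∈S = n∉S (subst (S M) (*-identityʳ n) (S-*-closed n 1∈S))

module Intervals (M : NumericalMonoid) where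
  open FinSubsets M

  c : ℕ
  c = proj₁ (conductor M)

  c≤⇒S : ∀ {n} → c ≤ n → S M n
  c≤⇒S = proj₂ (conductor M) _

  -- the integer interval [c + v, c + v + L]; the shift by the conductor keeps it inside S
  interval : ℕ → ℕ → FS
  interval v L = fsub (c + (v + 0)) (map (λ k → c + (v + k)) (applyUpTo suc L)) (All.tabulate in-S)
    where
      in-S : ∀ {n} → n ∈ map (λ k → c + (v + k)) (upTo (suc L)) → S M n
      in-S p with k , _ , refl ← ∈-map⁻ (λ k → c + (v + k)) p = c≤⇒S (m≤m+n c (v + k))

  ∈-interval⁺ : ∀ {v L k n} → k ≤ L → n ≡ c + (v + k) → n ∈ₛ interval v L
  ∈-interval⁺ {v} k≤L refl = ⟨ ∈-map⁺ (λ k → c + (v + k)) (∈-upTo⁺ (s≤s k≤L)) ⟩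

  ∈-interval⁻ : ∀ {v L n} → n ∈ₛ interval v L → ∃ λ k → k ≤ L × n ≡ c + (v + k)
  ∈-interval⁻ {v} p with k , k∈ , eq ← ∈-map⁻ (λ k → c + (v + k)) (get p) = k , ≤-pred (∈-upTo⁻ k∈) , eq

  interval-cong : ∀ {v v' L L'} → v ≡ v' → L ≡ L' → interval v L ≈ interval v' L'
  interval-cong refl refl = ≈-refl

  interval-⊆ : ∀ {v L v' L'} → v ≤ v' → v' + L' ≤ v + L → ∀ {n} → n ∈ₛ interval v' L' → n ∈ₛ interval v L
  interval-⊆ {v} {L} v≤v' ≤v+L p with ∈-interval⁻ p | m≤n⇒∃[o]m+o≡n v≤v'
  ... | k , k≤L' , refl | t , refl =
    ∈-interval⁺ (+-cancelˡ-≤ v (t + k) L (≤-trans (≤-reflexive (sym (+-assoc v t k))) (≤-trans (+-monoʳ-≤ (v + t) k≤L') ≤v+L)))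
                (cong (c +_) (+-assoc v t k))

  interval-bounds : ∀ {v L n} → n ∈ₛ interval v L → c + v ≤ n × n ≤ c + (v + L)
  interval-bounds {v} p with ∈-interval⁻ p
  ... | k , k≤L , refl = +-monoʳ-≤ c (m≤m+n v k) , +-monoʳ-≤ c (+-monoʳ-≤ v k≤L)

  interval-⊕ : ∀ v w L L' → interval v L ⊕ interval w L' ≈ interval (c + (v + w)) (L + L')
  interval-⊕ v w L L' = ⟪ to , from ⟫
    where
      to : ∀ {n} → n ∈ₛ interval v L ⊕ interval w L' → n ∈ₛ interval (c + (v + w)) (L + L')
      to p with ∈-⊕⁻ {interval v L} {interval w L'} p
      ... | _ , _ , x∈ , y∈ , refl with ∈-interval⁻ x∈ | ∈-interval⁻ y∈
      ... | k , k≤L , refl | k' , k'≤L' , refl = ∈-interval⁺ (+-mono-≤ k≤L k'≤L') (lemma c v k w k')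
        where
          lemma : ∀ c v k w k' → c + (v + k) + (c + (w + k')) ≡ c + (c + (v + w) + (k + k'))
          lemma = solve-∀
      from : ∀ {n} → n ∈ₛ interval (c + (v + w)) (L + L') → n ∈ₛ interval v L ⊕ interval w L'
      from p with k , k≤ , refl ← ∈-interval⁻ p | k ≤? L
      ... | yes k≤L = ∈-⊕⁺ (∈-interval⁺ k≤L refl) (∈-interval⁺ z≤n refl) (lemma c v w k)
        where
          lemma : ∀ c v w k → c + (c + (v + w) + k) ≡ c + (v + k) + (c + (w + 0))
          lemma = solve-∀
      ... | no k≰L with j , refl ← m≤n⇒∃[o]m+o≡n (<⇒≤ (≰⇒> k≰L)) =
        ∈-⊕⁺ (∈-interval⁺ ≤-refl refl) (∈-interval⁺ (+-cancelˡ-≤ L j L' k≤) refl) (lemma c v w L j)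
        where
          lemma : ∀ c v w L j → c + (c + (v + w) + (L + j)) ≡ c + (v + L) + (c + (w + j))
          lemma = solve-∀

  ⊕-interval : ∀ X {v L d} → max X ≡ min X + d → d ≤ L → X ⊕ interval v L ≈ interval (min X + v) (d + L)
  ⊕-interval X {v} {L} {d} max≡ d≤L = ⟪ to , from ⟫
    where
      m = min X
      to : ∀ {n} → n ∈ₛ X ⊕ interval v L → n ∈ₛ interval (m + v) (d + L)
      to p with ∈-⊕⁻ {X} {interval v L} p
      ... | x , _ , x∈ , y∈ , refl with ∈-interval⁻ y∈ | m≤n⇒∃[o]m+o≡n (min≤ X x∈)
      ... | k , k≤L , refl | i , refl =
        ∈-interval⁺ (+-mono-≤ (+-cancelˡ-≤ m i d (subst (m + i ≤_) max≡ (≤max X x∈))) k≤L) (lemma c m i v k)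
        where
          lemma : ∀ c m i v k → m + i + (c + (v + k)) ≡ c + (m + v + (i + k))
          lemma = solve-∀
      from : ∀ {n} → n ∈ₛ interval (m + v) (d + L) → n ∈ₛ X ⊕ interval v L
      from p with k , k≤ , refl ← ∈-interval⁻ p | k ≤? L
      ... | yes k≤L = ∈-⊕⁺ (min∈ X) (∈-interval⁺ k≤L refl) (lemma c m v k)
        where
          lemma : ∀ c m v k → c + (m + v + k) ≡ m + (c + (v + k))
          lemma = solve-∀
      ... | no k≰L with t , refl ← m≤n⇒∃[o]m+o≡n (≤-trans d≤L (<⇒≤ (≰⇒> k≰L))) =
        ∈-⊕⁺ (subst (_∈ₛ X) max≡ (max∈ X)) (∈-interval⁺ (+-cancelˡ-≤ d t L k≤) refl) (lemma c m v d t)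
        where
          lemma : ∀ c m v d t → c + (m + v + (d + t)) ≡ m + d + (c + (v + t))
          lemma = solve-∀

  single-⊕-interval : ∀ {s s∈S} v L → single s s∈S ⊕ interval v L ≈ interval (s + v) L
  single-⊕-interval {s} {s∈S} v L = ⊕-interval (single s s∈S) (sym (+-identityʳ s)) z≤n

  _∪_ : FS → FS → FS
  fsub a as (a∈S ∷ as⊆S) ∪ B = fsub a (as ++ elems B) (a∈S ∷ ++⁺ as⊆S (inS B))

  ∈-∪⁺ˡ : ∀ {A B n} → n ∈ₛ A → n ∈ₛ A ∪ B
  ∈-∪⁺ˡ {fsub a as (_ ∷ _)} ⟨ here eq ⟩ = ⟨ here eq ⟩
  ∈-∪⁺ˡ {fsub a as (_ ∷ _)} ⟨ there p ⟩ = ⟨ there (∈-++⁺ˡ p) ⟩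

  ∈-∪⁺ʳ : ∀ {A B n} → n ∈ₛ B → n ∈ₛ A ∪ B
  ∈-∪⁺ʳ {fsub a as (_ ∷ _)} p = ⟨ there (∈-++⁺ʳ as (get p)) ⟩

  ∈-∪⁻ : ∀ {A B n} → n ∈ₛ A ∪ B → n ∈ₛ A ⊎ n ∈ₛ B
  ∈-∪⁻ {fsub a as (_ ∷ _)} ⟨ here eq ⟩ = inj₁ ⟨ here eq ⟩
  ∈-∪⁻ {fsub a as (_ ∷ _)} ⟨ there p ⟩ with ∈-++⁻ as p
  ... | inj₁ q = inj₁ ⟨ there q ⟩
  ... | inj₂ q = inj₂ ⟨ q ⟩

module Cancellation (M : NumericalMonoid) where
  open FinSubsets M
  open Intervals M

  Cancellative : FS → Set
  Cancellative A = ∀ {Y Z} → A ⊕ Y ≈ A ⊕ Z → Y ≈ Z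

  single-cancellative : ∀ s s∈S → Cancellative (single s s∈S)
  single-cancellative s s∈S e = ⟪ cancel e , cancel (≈-sym e) ⟫
    where
      cancel : ∀ {Y Z} → single s s∈S ⊕ Y ≈ single s s∈S ⊕ Z → ∀ {n} → n ∈ₛ Y → n ∈ₛ Z
      cancel {Z = Z} e {n} y∈ with ∈-⊕⁻ {single s s∈S} {Z} (fw e (∈-⊕⁺ (hd∈ (single s s∈S)) y∈ refl))
      ... | _ , z , ⟨ here refl ⟩ , z∈ , eq = ∈-resp-≡ (sym (+-cancelˡ-≡ s n z eq)) z∈

  -- [c, c + 2d] with its midpoint c + d removed, where d = suc d₀
  punctured : ℕ → FS
  punctured d₀ = interval 0 d₀ ∪ interval (suc (suc d₀)) d₀

  module _ {d₀ : ℕ} where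
    private d = suc d₀

    punctured⊆interval : ∀ {n} → n ∈ₛ punctured d₀ → n ∈ₛ interval 0 (d + d)
    punctured⊆interval p with ∈-∪⁻ {interval 0 d₀} p
    ... | inj₁ q with ∈-interval⁻ q
    ...   | k , k≤d₀ , eq = ∈-interval⁺ (≤-trans (≤-trans k≤d₀ (n≤1+n d₀)) (m≤m+n d d)) eq
    punctured⊆interval p | inj₂ q with ∈-interval⁻ q
    ...   | k , k≤d₀ , eq = ∈-interval⁺ (subst (suc d + k ≤_) (sym (+-suc d d₀)) (s≤s (+-monoʳ-≤ d k≤d₀))) eq

    interval⊆punctured∪midpoint : ∀ {n} → n ∈ₛ interval 0 (d + d) → n ∈ₛ punctured d₀ ⊎ n ≡ c + d
    interval⊆punctured∪midpoint p with ∈-interval⁻ p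
    ... | k , k≤ , eq with k ≤? d₀
    ...   | yes k≤d₀ = inj₁ (∈-∪⁺ˡ (∈-interval⁺ k≤d₀ eq))
    ...   | no k≰d₀ with m≤n⇒∃[o]m+o≡n (≰⇒> k≰d₀)
    ...     | zero , refl = inj₂ (trans eq (cong (c +_) (+-identityʳ d)))
    ...     | suc j , refl = inj₁ (∈-∪⁺ʳ {interval 0 d₀} (∈-interval⁺ j≤d₀ (trans eq (lemma c d j))))
      where
        j≤d₀ : j ≤ d₀
        j≤d₀ = ≤-pred (+-cancelˡ-≤ d (suc j) d k≤)
        lemma : ∀ c d j → c + (d + suc j) ≡ c + (suc d + j)
        lemma = solve-∀

    midpoint∉punctured : ¬ (c + d ∈ₛ punctured d₀)
    midpoint∉punctured p with ∈-∪⁻ {interval 0 d₀} p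
    ... | inj₁ q with ∈-interval⁻ q
    ...   | k , k≤d₀ , eq = <⇒≱ (s≤s k≤d₀) (≤-reflexive (+-cancelˡ-≡ c d k eq))
    midpoint∉punctured p | inj₂ q with ∈-interval⁻ q
    ...   | k , _ , eq = m≢1+m+n d (+-cancelˡ-≡ c d (suc d + k) eq)

    -- The sums x + (c + d) are recovered from the ends of X.
    ⊕-punctured : ∀ X → max X ≡ min X + d → X ⊕ interval 0 (d + d) ≈ X ⊕ punctured d₀
    ⊕-punctured X max≡ = ⟪ to , ⊕-mono (λ x∈ → x∈) punctured⊆interval ⟫
      where
        m = min X
        midpoint-sum : ∀ {x} → x ∈ₛ X → x + (c + d) ∈ₛ X ⊕ punctured d₀
        midpoint-sum x∈ with m≤n⇒∃[o]m+o≡n (min≤ X x∈)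
        ... | zero , refl = ∈-⊕⁺ (subst (_∈ₛ X) max≡ (max∈ X)) (∈-∪⁺ˡ (∈-interval⁺ z≤n refl)) (lemma₁ c m d)
          where
            lemma₁ : ∀ c m d → m + 0 + (c + d) ≡ m + d + (c + 0)
            lemma₁ = solve-∀
        ... | suc i , refl = ∈-⊕⁺ (min∈ X) (∈-∪⁺ʳ {interval 0 d₀} (∈-interval⁺ i≤d₀ refl)) (lemma₂ c m d i)
          where
            i≤d₀ : i ≤ d₀
            i≤d₀ = ≤-pred (+-cancelˡ-≤ m (suc i) d (subst (m + suc i ≤_) max≡ (≤max X x∈)))
            lemma₂ : ∀ c m d i → m + suc i + (c + d) ≡ m + (c + (suc d + i))
            lemma₂ = solve-∀
        to : ∀ {n} → n ∈ₛ X ⊕ interval 0 (d + d) → n ∈ₛ X ⊕ punctured d₀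
        to p with ∈-⊕⁻ {X} {interval 0 (d + d)} p
        ... | x , y , x∈ , y∈ , refl with interval⊆punctured∪midpoint y∈
        ...   | inj₁ y∈′ = ∈-⊕⁺ x∈ y∈′ refl
        ...   | inj₂ refl = midpoint-sum x∈

  min<max⇒¬cancellative : ∀ X → min X < max X → ¬ Cancellative X
  min<max⇒¬cancellative X min<max cancel with m≤n⇒∃[o]m+o≡n min<max
  ... | d₀ , eq = midpoint∉punctured (fw (cancel (⊕-punctured X max≡)) (∈-interval⁺ (m≤m+n d d) refl))
    where
      d = suc d₀
      max≡ : max X ≡ min X + d
      max≡ = trans (sym eq) (sym (+-suc (min X) d₀))

  cancellative⇒singleton : ∀ X → Cancellative X → X ≈ single (hd X) (hd∈S X)
  cancellative⇒singleton X cancel with singleton⊎min<max X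
  ... | inj₁ X≈single = X≈single
  ... | inj₂ min<max = ⊥-elim (min<max⇒¬cancellative X min<max cancel)

∣-*-foldr-gcd : ∀ {k r} gs → (∀ {g} → g ∈ gs → k ∣ r * g) → k ∣ r * foldr gcd 0 gs
∣-*-foldr-gcd {k} {r} []       _   = subst (k ∣_) (sym (*-zeroʳ r)) (k ∣0)
∣-*-foldr-gcd {k} {r} (g ∷ gs) k∣ =
  subst (k ∣_) (sym (c*gcd[m,n]≡gcd[cm,cn] r g (foldr gcd 0 gs)))
    (gcd-greatest (k∣ (here refl)) (∣-*-foldr-gcd {k} {r} gs (k∣ ∘ there)))

∣-*-S⇒∣ : ∀ (M : NumericalMonoid) {k r} → (∀ {g} → S M g → k ∣ r * g) → k ∣ r
∣-*-S⇒∣ M {k} {r} k∣ with gcd≡1 M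
... | gs , gs⊆S , gcd≡1 =
  subst (k ∣_) (trans (cong (r *_) gcd≡1) (*-identityʳ r)) (∣-*-foldr-gcd {k} {r} gs (k∣ ∘ All.lookup gs⊆S))

module Isomorphism {M₁ M₂ : NumericalMonoid} (I : PfinIso M₁ M₂) where
  open PfinIso I public
  module A = FinSubsets M₁
  module B = FinSubsets M₂
  open Cancellation using (Cancellative)

  to-cong≈ : ∀ {X Y} → X A.≈ Y → to X B.≈ to Y
  to-cong≈ e = B.≋⇒≈ (to-cong (A.≈⇒≋ e))

  from-cong≈ : ∀ {X Y} → X B.≈ Y → from X A.≈ from Y
  from-cong≈ e = A.≋⇒≈ (from-cong (B.≈⇒≋ e))

  to-⊕≈ : ∀ X Y → to (X ⊕ Y) B.≈ to X ⊕ to Y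
  to-⊕≈ X Y = B.≋⇒≈ (to-⊕ X Y)

  to-injective : ∀ {X Y} → to X B.≈ to Y → X A.≈ Y
  to-injective {X} {Y} e = A.≈-trans (A.≈-sym (A.≋⇒≈ (from-to X))) (A.≈-trans (from-cong≈ e) (A.≋⇒≈ (from-to Y)))

  from-⊕≈ : ∀ X Y → from (X ⊕ Y) A.≈ from X ⊕ from Y
  from-⊕≈ X Y = to-injective (begin
    to (from (X ⊕ Y))            ≈⟨ B.≋⇒≈ (to-from (X ⊕ Y)) ⟩
    X ⊕ Y                        ≈⟨ B.⊕-cong (B.≋⇒≈ (to-from X)) (B.≋⇒≈ (to-from Y)) ⟨
    to (from X) ⊕ to (from Y)    ≈⟨ to-⊕≈ (from X) (from Y) ⟨
    to (from X ⊕ from Y)         ∎)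
    where open B.≈-Reasoning

  to-𝟘≈ : to 𝟘 B.≈ 𝟘
  to-𝟘≈ = B.≋⇒≈ {to 𝟘} {𝟘} to-𝟘

  from-𝟘≈ : from 𝟘 A.≈ 𝟘
  from-𝟘≈ = to-injective (B.≈-trans (B.≋⇒≈ (to-from 𝟘)) (B.≈-sym to-𝟘≈))

  to-cancellative : ∀ {X} → Cancellative M₁ X → Cancellative M₂ (to X)
  to-cancellative {X} cancel {Y} {Z} e = begin
    Y                ≈⟨ B.≋⇒≈ (to-from Y) ⟨
    to (from Y)      ≈⟨ to-cong≈ (cancel (to-injective (begin
      to (X ⊕ from Y)        ≈⟨ to-⊕≈ X (from Y) ⟩
      to X ⊕ to (from Y)     ≈⟨ B.⊕-cong B.≈-refl (B.≋⇒≈ (to-from Y)) ⟩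
      to X ⊕ Y               ≈⟨ e ⟩
      to X ⊕ Z               ≈⟨ B.⊕-cong B.≈-refl (B.≋⇒≈ (to-from Z)) ⟨
      to X ⊕ to (from Z)     ≈⟨ to-⊕≈ X (from Z) ⟨
      to (X ⊕ from Z)        ∎))) ⟩
    to (from Z)      ≈⟨ B.≋⇒≈ (to-from Z) ⟩
    Z                ∎
    where open B.≈-Reasoning

  -- Singletons are exactly the cancellative elements, so `to` maps {s} to a singleton {τ s}.
  τ : ∀ s → S M₁ s → ℕ
  τ s s∈S = hd (to (A.single s s∈S))

  τ∈S : ∀ s s∈S → S M₂ (τ s s∈S)
  τ∈S s s∈S = B.hd∈S (to (A.single s s∈S))

  to-single : ∀ s s∈S → to (A.single s s∈S) B.≈ B.single (τ s s∈S) (τ∈S s s∈S)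
  to-single s s∈S = Cancellation.cancellative⇒singleton M₂ _
    (to-cancellative (Cancellation.single-cancellative M₁ s s∈S))

  τ-irrelevant : ∀ {s t s∈S t∈S} → s ≡ t → τ s s∈S ≡ τ t t∈S
  τ-irrelevant {s} {s∈S = s∈S} {t∈S} refl = B.single-injective
    (B.≈-trans (B.≈-sym (to-single s s∈S)) (B.≈-trans (to-cong≈ (A.single-cong refl)) (to-single s t∈S)))

  τ-+ : ∀ a b a∈S b∈S ab∈S → τ (a + b) ab∈S ≡ τ a a∈S + τ b b∈S
  τ-+ a b a∈S b∈S ab∈S = B.single-injective {b∈S = +-closed M₂ (τ∈S a a∈S) (τ∈S b b∈S)} (begin
    B.single (τ (a + b) ab∈S) _                     ≈⟨ to-single (a + b) ab∈S ⟨
    to (A.single (a + b) ab∈S)                      ≈⟨ to-cong≈ A.single-⊕ ⟨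
    to (A.single a a∈S ⊕ A.single b b∈S)           ≈⟨ to-⊕≈ _ _ ⟩
    to (A.single a a∈S) ⊕ to (A.single b b∈S)      ≈⟨ B.⊕-cong (to-single a a∈S) (to-single b b∈S) ⟩
    B.single (τ a a∈S) _ ⊕ B.single (τ b b∈S) _    ≈⟨ B.single-⊕ ⟩
    B.single (τ a a∈S + τ b b∈S) _                  ∎)
    where open B.≈-Reasoning

  τ-0 : ∀ 0∈S → τ 0 0∈S ≡ 0
  τ-0 0∈S = B.single-injective (B.≈-trans (B.≈-sym (to-single 0 0∈S))
              (B.≈-trans (to-cong≈ (A.single-cong refl)) to-𝟘≈))

  τ-* : ∀ k a a∈S → τ (k * a) (S-*-closed M₁ k a∈S) ≡ k * τ a a∈S
  τ-* zero    a a∈S = τ-0 _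
  τ-* (suc k) a a∈S = trans (τ-+ a (k * a) a∈S _ _) (cong (τ a a∈S +_) (τ-* k a a∈S))

  τ-homogeneous : ∀ a a∈S b b∈S → b * τ a a∈S ≡ a * τ b b∈S
  τ-homogeneous a a∈S b b∈S = trans (sym (τ-* b a a∈S)) (trans (τ-irrelevant (*-comm b a)) (τ-* a b b∈S))

PfinIso-sym : ∀ {M₁ M₂} → PfinIso M₁ M₂ → PfinIso M₂ M₁
PfinIso-sym {M₁} I = record
  { to = from ; from = to ; to-cong = from-cong ; from-cong = to-cong
  ; from-to = to-from ; to-from = from-to
  ; to-⊕ = λ X Y → A.≈⇒≋ (from-⊕≈ X Y) ; to-𝟘 = A.≈⇒≋ from-𝟘≈ }
  where open Isomorphism I

module _ {M₁ M₂ : NumericalMonoid} (I : PfinIso M₁ M₂) where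
  open Isomorphism I
  private module I⁻¹ = Isomorphism (PfinIso-sym I)

  τ-τ⁻¹ : ∀ g g∈S → τ (I⁻¹.τ g g∈S) (I⁻¹.τ∈S g g∈S) ≡ g
  τ-τ⁻¹ g g∈S = B.single-injective (begin
    B.single (τ (I⁻¹.τ g g∈S) _) _    ≈⟨ to-single _ _ ⟨
    to (A.single (I⁻¹.τ g g∈S) _)     ≈⟨ to-cong≈ (I⁻¹.to-single g g∈S) ⟨
    to (from (B.single g g∈S))        ≈⟨ B.≋⇒≈ (to-from (B.single g g∈S)) ⟩
    B.single g g∈S                    ∎)
    where open B.≈-Reasoning

  -- By homogeneity h ∣ τ(h) g for all g ∈ S M₁ and τ(h) ∣ h g for all g ∈ S M₂;
  -- as both monoids have gcd 1, τ(h) = h.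
  τ-identity : ∀ n n∈S → τ n n∈S ≡ n
  τ-identity n n∈S = *-cancelˡ-≡ (τ n n∈S) n h (begin
    h * τ n n∈S   ≡⟨ τ-homogeneous n n∈S h h∈S ⟩
    n * τ h h∈S   ≡⟨ cong (n *_) τh≡h ⟩
    n * h         ≡⟨ *-comm n h ⟩
    h * n         ∎)
    where
      open ≡-Reasoning
      h = suc (proj₁ (conductor M₁))
      h∈S = proj₂ (conductor M₁) h (n≤1+n _)
      h∣τh : h ∣ τ h h∈S
      h∣τh = ∣-*-S⇒∣ M₁ λ {g} g∈S →
        divides (τ g g∈S) (trans (*-comm (τ h h∈S) g) (trans (τ-homogeneous h h∈S g g∈S) (*-comm h _)))
      τh∣h : τ h h∈S ∣ h
      τh∣h = ∣-*-S⇒∣ M₂ λ {g} g∈S →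
        divides (I⁻¹.τ g g∈S) (trans (cong (h *_) (sym (τ-τ⁻¹ g g∈S))) (τ-homogeneous _ (I⁻¹.τ∈S g g∈S) h h∈S))
      τh≡h : τ h h∈S ≡ h
      τh≡h = ∣-antisym τh∣h h∣τh

  PfinIso⇒⊆ : ∀ n → S M₁ n → S M₂ n
  PfinIso⇒⊆ n n∈S = subst (S M₂) (τ-identity n n∈S) (τ∈S n n∈S)

module DirectSums (M : NumericalMonoid) where
  open FinSubsets M
  open Intervals M

  mem-resp≈ : ∀ (H : Submonoid M) {A B} → A ≈ B → mem H A → mem H B
  mem-resp≈ H e = mem-resp H (≈⇒≋ e)

  mem-single-* : ∀ (H : Submonoid M) {b b∈S} → mem H (single b b∈S) → ∀ k → mem H (single (k * b) (S-*-closed M k b∈S))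
  mem-single-* H b∈H zero    = mem-𝟘 H
  mem-single-* H b∈H (suc k) = mem-resp≈ H single-⊕ (mem-⊕ H b∈H (mem-single-* H b∈H k))

  IsDirectSum-comm : ∀ {H₁ H₂} → IsDirectSum H₁ H₂ → IsDirectSum H₂ H₁
  IsDirectSum-comm (decompose , unique) =
    (λ A → let h₁ , h₂ , h₁∈ , h₂∈ , e = decompose A in
           h₂ , h₁ , h₂∈ , h₁∈ , ≈⇒≋ (≈-trans (≋⇒≈ {A} e) (⊕-comm h₁ h₂))) ,
    (λ h₂ h₁ h₂' h₁' h₂∈ h₁∈ h₂'∈ h₁'∈ e →
       let e₁ , e₂ = unique h₁ h₂ h₁' h₂' h₁∈ h₂∈ h₁'∈ h₂'∈
                       (≈⇒≋ (≈-trans (⊕-comm h₁ h₂) (≈-trans (≋⇒≈ {h₂ ⊕ h₁} e) (⊕-comm h₂' h₁'))))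
       in e₂ , e₁)

  module Components {H₁ H₂ : Submonoid M} (ds : IsDirectSum H₁ H₂) where

    π₁ π₂ : FS → FS
    π₁ X = proj₁ (proj₁ ds X)
    π₂ X = proj₁ (proj₂ (proj₁ ds X))

    π₁∈H₁ : ∀ X → mem H₁ (π₁ X)
    π₁∈H₁ X = proj₁ (proj₂ (proj₂ (proj₁ ds X)))

    π₂∈H₂ : ∀ X → mem H₂ (π₂ X)
    π₂∈H₂ X = proj₁ (proj₂ (proj₂ (proj₂ (proj₁ ds X))))

    π-decomposes : ∀ X → X ≈ π₁ X ⊕ π₂ X
    π-decomposes X = ≋⇒≈ (proj₂ (proj₂ (proj₂ (proj₂ (proj₁ ds X)))))

    π-unique : ∀ {X h₁ h₂} → mem H₁ h₁ → mem H₂ h₂ → X ≈ h₁ ⊕ h₂ → h₁ ≈ π₁ X × h₂ ≈ π₂ X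
    π-unique {X} {h₁} {h₂} h₁∈ h₂∈ e =
      let e₁ , e₂ = proj₂ ds h₁ h₂ (π₁ X) (π₂ X) h₁∈ h₂∈ (π₁∈H₁ X) (π₂∈H₂ X)
                      (≈⇒≋ (≈-trans (≈-sym e) (π-decomposes X)))
      in ≋⇒≈ e₁ , ≋⇒≈ e₂

    π₂-unique : ∀ {X h₁ h₂} → mem H₁ h₁ → mem H₂ h₂ → X ≈ h₁ ⊕ h₂ → h₂ ≈ π₂ X
    π₂-unique h₁∈ h₂∈ e = proj₂ (π-unique h₁∈ h₂∈ e)

    π₂-cong : ∀ {X Y} → X ≈ Y → π₂ X ≈ π₂ Y
    π₂-cong {X} e = π₂-unique (π₁∈H₁ X) (π₂∈H₂ X) (≈-trans (≈-sym e) (π-decomposes X))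

    π₂-⊕ : ∀ X Y → π₂ (X ⊕ Y) ≈ π₂ X ⊕ π₂ Y
    π₂-⊕ X Y = ≈-sym (π₂-unique (mem-⊕ H₁ (π₁∈H₁ X) (π₁∈H₁ Y)) (mem-⊕ H₂ (π₂∈H₂ X) (π₂∈H₂ Y))
                 (≈-trans (⊕-cong (π-decomposes X) (π-decomposes Y)) (⊕-interchange (π₁ X) (π₂ X) (π₁ Y) (π₂ Y))))

    single∈H₁∩H₂⇒0 : ∀ {z z∈S} → mem H₁ (single z z∈S) → mem H₂ (single z z∈S) → z ≡ 0
    single∈H₁∩H₂⇒0 {z} {z∈S} z∈H₁ z∈H₂ = single-injective (≈-trans
      (proj₁ (π-unique z∈H₁ (mem-𝟘 H₂) (≈-sym (⊕-identityʳ (single z z∈S)))))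
      (≈-sym (proj₁ (π-unique (mem-𝟘 H₁) z∈H₂ (≈-sym (⊕-identityˡ (single z z∈S)))))))

  module _ {H₁ H₂ : Submonoid M} (ds : IsDirectSum H₁ H₂) (¬1∈S : ¬ S M 1)
           {a : ℕ} {a∈S : S M a} (0<a : 0 < a) (a∈H₁ : mem H₁ (single a a∈S)) where
    open Components {H₁} {H₂} ds

    single∈H₂⇒0 : ∀ {b b∈S} → mem H₂ (single b b∈S) → b ≡ 0
    single∈H₂⇒0 {zero}  _    = refl
    single∈H₂⇒0 {suc b} b∈H₂ = ⊥-elim (<⇒≢ (<-≤-trans 0<a (m≤m+n a (b * a))) (sym ab≡0))
      where
        ab≡0 : suc b * a ≡ 0
        ab≡0 = single∈H₁∩H₂⇒0 (mem-single-* H₁ a∈H₁ (suc b))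
                 (mem-resp≈ H₂ (single-cong (*-comm a (suc b))) (mem-single-* H₂ b∈H₂ a))

    single∈H₁ : ∀ n n∈S → mem H₁ (single n n∈S)
    single∈H₁ n n∈S = mem-resp≈ H₁ π₁X≈X (π₁∈H₁ X)
      where
        X = single n n∈S
        π₂X≈single : π₂ X ≈ single (hd (π₂ X)) (hd∈S (π₂ X))
        π₂X≈single = single-summand (π₂ X) (π₁ X) (≈-trans (π-decomposes X) (⊕-comm (π₁ X) (π₂ X)))
        π₂X≈𝟘 : π₂ X ≈ 𝟘
        π₂X≈𝟘 = ≈-trans π₂X≈single (single-cong (single∈H₂⇒0 (mem-resp≈ H₂ π₂X≈single (π₂∈H₂ X))))
        π₁X≈X : π₁ X ≈ X
        π₁X≈X = ≈-sym (≈-trans (π-decomposes X) (≈-trans (⊕-cong ≈-refl π₂X≈𝟘) (⊕-identityʳ (π₁ X))))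

    π₂-shift : ∀ s s∈S v L → π₂ (interval (s + v) L) ≈ π₂ (interval v L)
    π₂-shift s s∈S v L = ≈-sym (π₂-unique (mem-⊕ H₁ (single∈H₁ s s∈S) (π₁∈H₁ Y)) (π₂∈H₂ Y) (begin
      interval (s + v) L               ≈⟨ single-⊕-interval v L ⟨
      single s s∈S ⊕ Y                 ≈⟨ ⊕-cong ≈-refl (π-decomposes Y) ⟩
      single s s∈S ⊕ (π₁ Y ⊕ π₂ Y)     ≈⟨ ⊕-assoc _ _ _ ⟨
      (single s s∈S ⊕ π₁ Y) ⊕ π₂ Y     ∎))
      where
        Y = interval v L
        open ≈-Reasoning

    π₂-interval-translation : ∀ v w L → π₂ (interval v L) ≈ π₂ (interval w L)
    π₂-interval-translation v w L = begin
      π₂ (interval v L)                ≈⟨ π₂-shift (c + w) (c≤⇒S (m≤m+n c w)) v L ⟨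
      π₂ (interval (c + w + v) L)      ≈⟨ π₂-cong (interval-cong (lemma c w v) refl) ⟩
      π₂ (interval (c + v + w) L)      ≈⟨ π₂-shift (c + v) (c≤⇒S (m≤m+n c v)) w L ⟩
      π₂ (interval w L)                ∎
      where
        open ≈-Reasoning
        lemma : ∀ c w v → c + w + v ≡ c + v + w
        lemma = solve-∀

    -- by π₂-interval-translation, the H₂-component of every interval of length L
    Q : ℕ → FS
    Q L = π₂ (interval 0 L)

    Q-+ : ∀ L L' → Q (L + L') ≈ Q L ⊕ Q L'
    Q-+ L L' = begin
      Q (L + L')                               ≈⟨ π₂-interval-translation 0 (c + (0 + 0)) (L + L') ⟩
      π₂ (interval (c + (0 + 0)) (L + L'))     ≈⟨ π₂-cong (interval-⊕ 0 0 L L') ⟨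
      π₂ (interval 0 L ⊕ interval 0 L')        ≈⟨ π₂-⊕ (interval 0 L) (interval 0 L') ⟩
      Q L ⊕ Q L'                               ∎
      where open ≈-Reasoning

    Q-bounded : ∀ L {e} → e ∈ₛ Q L → e ≤ c + L
    Q-bounded L {e} e∈Q with ∈-interval⁻ (bw (π-decomposes Y) (∈-⊕⁺ (hd∈ (π₁ Y)) e∈Q refl))
      where Y = interval 0 L
    ... | k , k≤L , eq = ≤-trans (m≤n+m e _) (≤-trans (≤-reflexive eq) (+-monoʳ-≤ c k≤L))

    Q-multiple : ∀ k {e} → e ∈ₛ Q 1 → suc k * e ∈ₛ Q (suc k)
    Q-multiple zero    {e} e∈Q = ∈-resp-≡ (sym (+-identityʳ e)) e∈Q
    Q-multiple (suc k) {e} e∈Q = bw (Q-+ 1 (suc k)) (∈-⊕⁺ e∈Q (Q-multiple k e∈Q) refl)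

    -- e ∈ Q 1 gives (c + 1) e ≤ 2 c + 1, so e ≤ 1, and e ≠ 1 as 1 ∉ S.
    Q1⊆𝟘 : ∀ {e} → e ∈ₛ Q 1 → e ≡ 0
    Q1⊆𝟘 {zero}        _   = refl
    Q1⊆𝟘 {suc zero}    e∈Q = ⊥-elim (¬1∈S (∈ₛ⇒S e∈Q))
    Q1⊆𝟘 {suc (suc e)} e∈Q = ⊥-elim (<⇒≱ (s≤s (m≤m+n (c + suc c) (suc c * e)))
      (subst (_≤ c + suc c) (lemma c e) (Q-bounded (suc c) (Q-multiple c e∈Q))))
      where
        lemma : ∀ c e → suc c * suc (suc e) ≡ suc (c + suc c + suc c * e)
        lemma = solve-∀

    Q≈𝟘 : ∀ L → Q L ≈ 𝟘
    Q≈𝟘 zero    = ≈-sym (π₂-unique (single∈H₁ _ (hd∈S (interval 0 0))) (mem-𝟘 H₂)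
                           (≈-sym (⊕-identityʳ (interval 0 0))))
    Q≈𝟘 (suc L) = ≈-trans (Q-+ 1 L) (≈-trans (⊕-cong (⊆𝟘⇒≈𝟘 Q1⊆𝟘) (Q≈𝟘 L)) (⊕-identityʳ 𝟘))

    -- B ⊕ [c, c + d] is an interval when d is the diameter of B, so B ⊕ Q d ≈ B
    -- is the H₂-component of an interval.
    H₂-trivial : IsTrivial H₂
    H₂-trivial B B∈H₂ = ≈⇒≋ (begin
      B                      ≈⟨ ⊕-identityʳ B ⟨
      B ⊕ 𝟘                  ≈⟨ ⊕-cong ≈-refl (Q≈𝟘 d) ⟨
      B ⊕ Q d                ≈⟨ π₂-unique (π₁∈H₁ Y) (mem-⊕ H₂ B∈H₂ (π₂∈H₂ Y)) B⊕Y≈ ⟩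
      π₂ (interval (min B + 0) (d + d))  ≈⟨ π₂-interval-translation (min B + 0) 0 (d + d) ⟩
      Q (d + d)              ≈⟨ Q≈𝟘 (d + d) ⟩
      𝟘                      ∎)
      where
        open ≈-Reasoning
        d = proj₁ (diameter B)
        Y = interval 0 d
        B⊕Y≈ : interval (min B + 0) (d + d) ≈ π₁ Y ⊕ (B ⊕ π₂ Y)
        B⊕Y≈ = begin
          interval (min B + 0) (d + d)  ≈⟨ ⊕-interval B (proj₂ (diameter B)) ≤-refl ⟨
          B ⊕ Y                    ≈⟨ ⊕-cong ≈-refl (π-decomposes Y) ⟩
          B ⊕ (π₁ Y ⊕ π₂ Y)        ≈⟨ ⊕-assoc _ _ _ ⟨
          (B ⊕ π₁ Y) ⊕ π₂ Y        ≈⟨ ⊕-cong (⊕-comm B (π₁ Y)) ≈-refl ⟩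
          (π₁ Y ⊕ B) ⊕ π₂ Y        ≈⟨ ⊕-assoc _ _ _ ⟩
          π₁ Y ⊕ (B ⊕ π₂ Y)        ∎

  -- {c + 1} = x ⊕ y forces x and y to be singletons, one of them positive.
  direct-sum-trivial : NotAllℕ M → ∀ H₁ H₂ → IsDirectSum H₁ H₂ → IsTrivial H₁ ⊎ IsTrivial H₂
  direct-sum-trivial notAllℕ H₁ H₂ ds = split (proj₁ ds X)
    where
      X = single (suc c) (c≤⇒S (n≤1+n c))
      split : (∃₂ λ x y → mem H₁ x × mem H₂ y × X ≋ x ⊕ y) → IsTrivial H₁ ⊎ IsTrivial H₂
      split (x , y , x∈H₁ , y∈H₂ , X≋x⊕y) with hd x in hd-x≡
      ... | suc n = inj₂ (H₂-trivial {H₁} {H₂} ds (¬1∈S M notAllℕ) {a∈S = n+1∈S} (s≤s z≤n)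
                           (mem-resp≈ H₁ (≈-trans (single-summand x y (≋⇒≈ {X} X≋x⊕y)) (single-cong hd-x≡)) x∈H₁))
        where
          n+1∈S : S M (suc n)
          n+1∈S = subst (S M) hd-x≡ (hd∈S x)
      ... | zero  = inj₁ (H₂-trivial {H₂} {H₁} (IsDirectSum-comm {H₁} {H₂} ds) (¬1∈S M notAllℕ) {a∈S = c+1∈S} (s≤s z≤n)
                           (mem-resp≈ H₂ (≈-trans (single-summand y x (≈-trans X≈x⊕y (⊕-comm x y))) (single-cong hd-y≡)) y∈H₂))
        where
          c+1∈S = c≤⇒S (n≤1+n c)
          X≈x⊕y = ≋⇒≈ {X} X≋x⊕y
          hd-y≡ : hd y ≡ suc c
          hd-y≡ = trans (cong (_+ hd y) (sym hd-x≡)) (∈-single⁻ (bw X≈x⊕y (∈-⊕⁺ (hd∈ x) (hd∈ y) refl)))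

offset-shift : ∀ c m d c' i j → m + d + c' ≡ c + (m + j) → m + c' ≡ c + (m + i) → j ≡ i + d
offset-shift c m d c' i j top bottom = +-cancelˡ-≡ m j (i + d) (+-cancelˡ-≡ c (m + j) (m + (i + d)) (begin
  c + (m + j)        ≡⟨ top ⟨
  m + d + c'         ≡⟨ lemma₁ m d c' ⟩
  m + c' + d         ≡⟨ cong (_+ d) bottom ⟩
  c + (m + i) + d    ≡⟨ lemma₂ c m i d ⟩
  c + (m + (i + d))  ∎))
  where
    open ≡-Reasoning
    lemma₁ : ∀ m d c' → m + d + c' ≡ m + c' + d
    lemma₁ = solve-∀
    lemma₂ : ∀ c m i d → c + (m + i) + d ≡ c + (m + (i + d))
    lemma₂ = solve-∀

¬¬-threshold : ∀ (P : ℕ → Set) → ¬ P 0 → ∀ N → P N → ¬ ¬ (∃ λ k → ¬ P k × P (suc k))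
¬¬-threshold P ¬P0 zero    PN _       = ¬P0 PN
¬¬-threshold P ¬P0 (suc N) PN ¬jump = ¬jump (N , (λ PN' → ¬¬-threshold P ¬P0 N PN' ¬jump) , PN)

module Primes (M : NumericalMonoid) where
  open FinSubsets M
  open Intervals M

  infix 4 _∣ₛ_
  _∣ₛ_ : FS → FS → Set
  P ∣ₛ X = Σ FS λ C → X ≈ P ⊕ C

  EuclidsProperty : FS → Set
  EuclidsProperty P = ∀ A B → P ∣ₛ (A ⊕ B) → P ∣ₛ A ⊎ P ∣ₛ B

  IsPrime⇒EuclidsProperty : ∀ {P} → IsPrime P → EuclidsProperty P
  IsPrime⇒EuclidsProperty (_ , prime) A B (C , e) with prime A B (C , ≈⇒≋ e)
  ... | inj₁ (C' , e') = inj₁ (C' , ≋⇒≈ {A} e')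
  ... | inj₂ (C' , e') = inj₂ (C' , ≋⇒≈ {B} e')

  ∣ₛ-resp-≈ : ∀ {P P' X} → P ≈ P' → P ∣ₛ X → P' ∣ₛ X
  ∣ₛ-resp-≈ e (C , e') = C , ≈-trans e' (⊕-cong e ≈-refl)

  ∣ₛ-resp-≈ʳ : ∀ {P X Y} → X ≈ Y → P ∣ₛ Y → P ∣ₛ X
  ∣ₛ-resp-≈ʳ e (C , e') = C , ≈-trans e e'

  EuclidsProperty-resp-≈ : ∀ {P P'} → P ≈ P' → EuclidsProperty P → EuclidsProperty P'
  EuclidsProperty-resp-≈ e euclid A B P'∣ =
    [ inj₁ ∘ ∣ₛ-resp-≈ e , inj₂ ∘ ∣ₛ-resp-≈ e ]′ (euclid A B (∣ₛ-resp-≈ (≈-sym e) P'∣))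

  multiple-top : ∀ {Q C X t} → X ≈ Q ⊕ C → t ∈ₛ X → (∀ {x} → x ∈ₛ X → x ≤ t) →
                 ∃ λ c' → max Q + c' ≡ t × min Q + c' ∈ₛ X
  multiple-top {Q} {C} e t∈ ≤t with ∈-⊕⁻ {Q} {C} (fw e t∈)
  ... | q , c' , q∈ , c'∈ , t≡ =
    c' , ≤-antisym (≤t (bw e (∈-⊕⁺ (max∈ Q) c'∈ refl))) (≤-trans (≤-reflexive t≡) (+-monoˡ-≤ c' (≤max Q q∈))) ,
    bw e (∈-⊕⁺ (min∈ Q) c'∈ refl)

  multiple-bottom : ∀ {Q C X b} → X ≈ Q ⊕ C → b ∈ₛ X → (∀ {x} → x ∈ₛ X → b ≤ x) →
                    ∃ λ c' → min Q + c' ≡ b × max Q + c' ∈ₛ X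
  multiple-bottom {Q} {C} e b∈ b≤ with ∈-⊕⁻ {Q} {C} (fw e b∈)
  ... | q , c' , q∈ , c'∈ , b≡ =
    c' , ≤-antisym (≤-trans (+-monoˡ-≤ c' (min≤ Q q∈)) (≤-reflexive (sym b≡))) (b≤ (bw e (∈-⊕⁺ (min∈ Q) c'∈ refl))) ,
    bw e (∈-⊕⁺ (max∈ Q) c'∈ refl)

  module _ (notAllℕ : NotAllℕ M) {p₀ : ℕ} (p∈S : S M (suc p₀)) where
    private
      p = suc p₀
      P = single p p∈S

    infix 4 _∈p+S
    _∈p+S : ℕ → Set
    x ∈p+S = ∃ λ s → S M s × x ≡ p + s

    ∣ₛ⇒∈p+S : ∀ {X x} → P ∣ₛ X → x ∈ₛ X → x ∈p+S
    ∣ₛ⇒∈p+S (C , e) x∈ with ∈-⊕⁻ {P} {C} (fw e x∈)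
    ... | _ , s , ⟨ here refl ⟩ , s∈ , eq = s , ∈ₛ⇒S s∈ , eq

    ∈p+S⇒∣ₛ : ∀ {z z∈S} → z ∈p+S → P ∣ₛ single z z∈S
    ∈p+S⇒∣ₛ (s , s∈S , refl) = single s s∈S , ≈-sym single-⊕

    -- For g ∉ S, the first k with g + k p ∈ S gives an element of S \ (p + S).
    ¬¬positive-apéry-element : ¬ ¬ (∃ λ w → S M w × 0 < w × ¬ w ∈p+S)
    ¬¬positive-apéry-element found =
      ¬¬-threshold (λ k → S M (g + k * p)) (g∉S ∘ subst (S M) (+-identityʳ g)) c
        (c≤⇒S (≤-trans (m≤m*n c p) (m≤n+m (c * p) g)))
        λ (k , ¬Pk , Pk+1) → found (g + suc k * p , Pk+1 , <-≤-trans z<s (m≤n+m (suc k * p) g) , ∉ k ¬Pk)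
      where
        g = proj₁ notAllℕ
        g∉S = proj₂ notAllℕ
        ∉ : ∀ k → ¬ S M (g + k * p) → ¬ g + suc k * p ∈p+S
        ∉ k ¬Pk (s , s∈S , eq) = ¬Pk (subst (S M) (+-cancelˡ-≡ p s (g + k * p) (trans (sym eq) (lemma p g k))) s∈S)
          where
            lemma : ∀ p g k → g + (p + k * p) ≡ p + (g + k * p)
            lemma = solve-∀

    multiples-∈p+S : ∀ {w} → 0 < w → suc (p + c) * w ∈p+S
    multiples-∈p+S {w} 0<w with m≤n⇒∃[o]m+o≡n (≤-trans (n≤1+n (p + c)) (m≤m*n (suc (p + c)) w {{>-nonZero 0<w}}))
    ... | t , eq = c + t , c≤⇒S (m≤m+n c t) , trans (sym eq) (+-assoc p c t)

    ¬EuclidsProperty-at-jump : EuclidsProperty P → ∀ {w} (w∈S : S M w) → ¬ w ∈p+S →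
                               ∀ j → ¬ suc j * w ∈p+S → ¬ suc (suc j) * w ∈p+S
    ¬EuclidsProperty-at-jump euclid {w} w∈S w∉ j ¬Qj Qj+1 =
      [ ¬Qj ∘ (λ P∣A → ∣ₛ⇒∈p+S P∣A (hd∈ A)) , w∉ ∘ (λ P∣B → ∣ₛ⇒∈p+S P∣B (hd∈ B)) ]′ (euclid A B P∣A⊕B)
      where
        A = single (suc j * w) (S-*-closed M (suc j) w∈S)
        B = single w w∈S
        P∣A⊕B : P ∣ₛ A ⊕ B
        P∣A⊕B = ∣ₛ-resp-≈ʳ (≈-trans (single-⊕ {ab∈S = +-closed M (hd∈S A) w∈S}) (single-cong (+-comm (suc j * w) w)))
                          (∈p+S⇒∣ₛ {z∈S = S-*-closed M (suc (suc j)) w∈S} Qj+1)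

    single-¬EuclidsProperty : ¬ EuclidsProperty P
    single-¬EuclidsProperty euclid = ¬¬positive-apéry-element λ (w , w∈S , 0<w , w∉) →
      ¬¬-threshold (λ j → suc j * w ∈p+S) (w∉ ∘ subst _∈p+S (+-identityʳ w)) (p + c) (multiples-∈p+S 0<w)
        λ (j , ¬Qj , Qj+1) → ¬EuclidsProperty-at-jump euclid w∈S w∉ j ¬Qj Qj+1

  module _ {Q : FS} {d₀ : ℕ} (max≡ : max Q ≡ min Q + suc d₀) where
    private
      m = min Q
      d = suc d₀
      T = suc (d + d)

      pt : ℕ → ℕ
      pt i = c + (m + i)

      m+T+0≡m+T : m + T + 0 ≡ m + T
      m+T+0≡m+T = +-identityʳ (m + T)

    -- offsets [0, d] ∪ {2d + 1} and {0} ∪ [d + 1, 2d + 1] from c + m; A ⊕ B is an interval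
    -- of length 4d + 2, while A lacks its maximum minus d and B its minimum plus d
    A B : FS
    A = interval m d ∪ interval (m + T) 0
    B = interval m 0 ∪ interval (m + suc d) d

    ∈A⁺ : ∀ {i} → i ≤ d ⊎ i ≡ T → pt i ∈ₛ A
    ∈A⁺ (inj₁ i≤d) = ∈-∪⁺ˡ {B = interval (m + T) 0} (∈-interval⁺ i≤d refl)
    ∈A⁺ (inj₂ refl) = ∈-∪⁺ʳ {interval m d} (∈-interval⁺ z≤n (cong (c +_) (sym m+T+0≡m+T)))

    ∈A⁻ : ∀ {n} → n ∈ₛ A → ∃ λ i → (i ≤ d ⊎ i ≡ T) × n ≡ pt i
    ∈A⁻ p with ∈-∪⁻ {interval m d} p
    ... | inj₁ q = let k , k≤d , eq = ∈-interval⁻ q in k , inj₁ k≤d , eq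
    ... | inj₂ q with ∈-interval⁻ q
    ...   | zero , _ , eq = T , inj₂ refl , trans eq (cong (c +_) m+T+0≡m+T)

    ∈B⁺ : ∀ {j} → j ≡ 0 ⊎ suc d ≤ j × j ≤ T → pt j ∈ₛ B
    ∈B⁺ (inj₁ refl) = ∈-∪⁺ˡ {interval m 0} {interval (m + suc d) d} (∈-interval⁺ z≤n refl)
    ∈B⁺ (inj₂ (d<j , j≤T)) with m≤n⇒∃[o]m+o≡n d<j
    ... | t , refl = ∈-∪⁺ʳ {interval m 0} (∈-interval⁺ (+-cancelˡ-≤ (suc d) t d j≤T)
                                             (cong (c +_) (sym (+-assoc m (suc d) t))))

    ∈B⁻ : ∀ {n} → n ∈ₛ B → ∃ λ j → (j ≡ 0 ⊎ suc d ≤ j) × n ≡ pt j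
    ∈B⁻ p with ∈-∪⁻ {interval m 0} p
    ... | inj₁ q with ∈-interval⁻ q
    ...   | zero , _ , eq = 0 , inj₁ refl , eq
    ∈B⁻ p | inj₂ q with ∈-interval⁻ q
    ...   | k , _ , eq = suc d + k , inj₂ (m≤m+n (suc d) k) , trans eq (cong (c +_) (+-assoc m (suc d) k))

    A⊆ : ∀ {n} → n ∈ₛ A → n ∈ₛ interval m T
    A⊆ p with ∈-∪⁻ {interval m d} p
    ... | inj₁ q = interval-⊆ ≤-refl (+-monoʳ-≤ m (≤-trans (m≤m+n d d) (n≤1+n (d + d)))) q
    ... | inj₂ q = interval-⊆ (m≤m+n m T) (≤-reflexive (+-identityʳ (m + T))) q

    B⊆ : ∀ {n} → n ∈ₛ B → n ∈ₛ interval m T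
    B⊆ p with ∈-∪⁻ {interval m 0} p
    ... | inj₁ q = interval-⊆ ≤-refl (+-monoʳ-≤ m z≤n) q
    ... | inj₂ q = interval-⊆ (m≤m+n m (suc d)) (≤-reflexive (lemma m d)) q
      where
        lemma : ∀ m d → m + suc d + d ≡ m + suc (d + d)
        lemma = solve-∀

    A⊕B≈interval : A ⊕ B ≈ interval (c + (m + m)) (T + T)
    A⊕B≈interval = ⟪ fw (interval-⊕ m m T T) ∘ ⊕-mono A⊆ B⊆ , from ⟫
      where
        sum∈ : ∀ {i j k} → i ≤ d ⊎ i ≡ T → j ≡ 0 ⊎ suc d ≤ j × j ≤ T → k ≡ i + j →
               c + (c + (m + m) + k) ∈ₛ A ⊕ B
        sum∈ {i} {j} i∈ j∈ refl = ∈-⊕⁺ (∈A⁺ i∈) (∈B⁺ j∈) (lemma c m i j)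
          where
            lemma : ∀ c m i j → c + (c + (m + m) + (i + j)) ≡ c + (m + i) + (c + (m + j))
            lemma = solve-∀
        from : ∀ {n} → n ∈ₛ interval (c + (m + m)) (T + T) → n ∈ₛ A ⊕ B
        from p with ∈-interval⁻ p
        ... | k , k≤ , refl with k ≤? T
        ...   | yes k≤T with k ≤? d
        ...     | yes k≤d = sum∈ (inj₁ k≤d) (inj₁ refl) (sym (+-identityʳ k))
        ...     | no k≰d = sum∈ (inj₁ z≤n) (inj₂ (≰⇒> k≰d , k≤T)) refl
        from p | k , k≤ , refl | no k≰T with m≤n⇒∃[o]m+o≡n (<⇒≤ (≰⇒> k≰T))
        ...   | u , refl with u ≤? d
        ...     | yes u≤d = sum∈ (inj₁ u≤d) (inj₂ (s≤s (m≤m+n d d) , ≤-refl)) (+-comm T u)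
        ...     | no u≰d = sum∈ (inj₂ refl) (inj₂ (≰⇒> u≰d , +-cancelˡ-≤ T u T k≤)) refl

    Q∣A⊕B : Q ∣ₛ A ⊕ B
    Q∣A⊕B = interval (c + m) L , (begin
      A ⊕ B                                ≈⟨ A⊕B≈interval ⟩
      interval (c + (m + m)) (T + T)       ≈⟨ interval-cong (lemma₁ c m) (lemma₂ d) ⟩
      interval (m + (c + m)) (d + L)       ≈⟨ ⊕-interval Q max≡ (≤-trans (m≤n+m d (d + d)) (≤-trans (n≤1+n _) (n≤1+n _))) ⟨
      Q ⊕ interval (c + m) L               ∎)
      where
        open ≈-Reasoning
        L = suc (suc (d + d + d))
        lemma₁ : ∀ c m → c + (m + m) ≡ m + (c + m)
        lemma₁ = solve-∀
        lemma₂ : ∀ d → suc (d + d) + suc (d + d) ≡ d + suc (suc (d + d + d))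
        lemma₂ = solve-∀

    ¬Q∣A : ¬ Q ∣ₛ A
    ¬Q∣A (C , e) with multiple-top e (∈A⁺ (inj₂ refl)) (λ x∈ → proj₂ (interval-bounds (A⊆ x∈)))
    ... | c' , top , bottom∈ with ∈A⁻ bottom∈
    ...   | i , i∈ , bottom with offset-shift c m d c' i T (trans (cong (_+ c') (sym max≡)) top) bottom
    ...     | T≡i+d with i∈
    ...       | inj₁ i≤d = <⇒≱ (≤-refl {T}) (≤-trans (≤-reflexive T≡i+d) (+-monoˡ-≤ d i≤d))
    ...       | inj₂ refl = m+1+n≢m T (sym T≡i+d)

    ¬Q∣B : ¬ Q ∣ₛ B
    ¬Q∣B (C , e) with multiple-bottom e (∈B⁺ (inj₁ refl))
                        (λ x∈ → ≤-trans (≤-reflexive (cong (c +_) (+-identityʳ m))) (proj₁ (interval-bounds (B⊆ x∈))))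
    ... | c' , bottom , top∈ with ∈B⁻ top∈
    ...   | j , j∈ , top with offset-shift c m d c' 0 j (trans (cong (_+ c') (sym max≡)) top) bottom
    ...     | j≡d with j∈
    ...       | inj₁ refl = 0≢1+n j≡d
    ...       | inj₂ d<j = <⇒≱ d<j (≤-reflexive j≡d)

    min<max⇒¬EuclidsProperty : ¬ EuclidsProperty Q
    min<max⇒¬EuclidsProperty euclid = [ ¬Q∣A , ¬Q∣B ]′ (euclid A B Q∣A⊕B)

  no-prime : NotAllℕ M → ¬ (∃ λ (P : FS) → IsPrime P)
  no-prime notAllℕ (P , P≉𝟘 , prime) with singleton⊎min<max P
  ... | inj₂ min<max with m≤n⇒∃[o]m+o≡n min<max
  ...   | d₀ , eq = min<max⇒¬EuclidsProperty {P} (trans (sym eq) (sym (+-suc (min P) d₀))) (IsPrime⇒EuclidsProperty {P} (P≉𝟘 , prime))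
  no-prime notAllℕ (P , P≉𝟘 , prime) | inj₁ P≈single = singleton-case (hd P) refl
    where
      singleton-case : ∀ n → hd P ≡ n → ⊥
      singleton-case zero     hd≡ = P≉𝟘 (≈⇒≋ (≈-trans P≈single (single-cong {b∈S = 0∈S M} hd≡)))
      singleton-case (suc p₀) hd≡ = single-¬EuclidsProperty notAllℕ (subst (S M) hd≡ (hd∈S P))
        (EuclidsProperty-resp-≈ (≈-trans P≈single (single-cong hd≡)) (IsPrime⇒EuclidsProperty {P} (P≉𝟘 , prime)))

theorem3p2 : (M : NumericalMonoid) → NotAllℕ M →
    (¬ (∃ λ (P : FinSub M) → IsPrime P))
    × ((H₁ H₂ : Submonoid M) → IsDirectSum H₁ H₂ → IsTrivial H₁ ⊎ IsTrivial H₂)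
    × ((M' : NumericalMonoid) → PfinIso M' M → (n : ℕ) → S M n ⇔ S M' n)
theorem3p2 M notAllℕ =
  Primes.no-prime M notAllℕ ,
  DirectSums.direct-sum-trivial M notAllℕ ,
  λ M' I n → mk⇔ (PfinIso⇒⊆ (PfinIso-sym I) n) (PfinIso⇒⊆ I n)
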